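{- Let $G=(V,A)$ be a permutation DAG and $\gamma$ an umbrella-free topological ordering of $G$. Then the $\gamma$-least fully suffix connected vertex has no outgoing arcs in $G$.
   Context: A directed graph is a permutation DAG if it is isomorphic to $\mathsf{PermDAG}(\tau)$ for some sequence $\tau$, where $\mathsf{PermDAG}(\tau)$ has vertices $t_1,\ldots,t_n$ and an arc $(t_j,t_i)$ for every $i<j$ with $\tau(i)\le\tau(j)$. A topological ordering of an $n$-vertex DAG $G=(V,A)$ is a bijection $\gamma:V\to[n]$ with $\gamma(u)<\gamma(v)$ for every arc $(v,u)\in A$. It is umbrella-free if for every $(v,u)\in A$ and every $w$ with $\gamma(u)<\gamma(w)<\gamma(v)$, $(w,u)\in A$ or $(v,w)\in A$. A vertex $u$ is fully suffix connected (w.r.t. $\gamma$) if $(v,u)\in A$ for every $v$ with $\gamma(v)>\gamma(u)$; the $\gamma$-least fully suffix connected vertex is the fully suffix connected vertex $u$ with smallest $\gamma(u)$. -}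

module Defs where

open import Data.Nat using (ℕ) renaming (_≤_ to _≤ℕ_)
open import Data.Fin using (Fin; _<_; _≤_)
open import Data.Sum using (_⊎_)
open import Data.Product using (Σ; _×_)
open import Relation.Binary.PropositionalEquality using (_≡_)
open import Function.Definitions using (Bijective)
open import Relation.Nullary using (¬_)

-- A directed graph on vertex set Fin n: Arc v u means there is an arc (v,u) from v to u.
Digraph : ℕ → Set₁
Digraph n = Fin n → Fin n → Set

PermDAG : ∀ {n} → (Fin n → ℕ) → Digraph n
PermDAG τ j i = (i < j) × (τ i ≤ℕ τ j)

Isomorphic : ∀ {n} → Digraph n → Digraph n → Set
Isomorphic {n} G H =
  Σ (Fin n → Fin n) λ f → Bijective _≡_ _≡_ f ×
    (∀ v u → (G v u → H (f v) (f u)) × (H (f v) (f u) → G v u))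

IsPermutationDAG : ∀ {n} → Digraph n → Set
IsPermutationDAG {n} G = Σ (Fin n → ℕ) λ τ → Isomorphic G (PermDAG τ)

IsTopOrdering : ∀ {n} → Digraph n → (Fin n → Fin n) → Set
IsTopOrdering G γ = Bijective _≡_ _≡_ γ × (∀ v u → G v u → γ u < γ v)

UmbrellaFree : ∀ {n} → Digraph n → (Fin n → Fin n) → Set
UmbrellaFree {n} G γ = ∀ v u → G v u → ∀ (w : Fin n) → γ u < γ w → γ w < γ v →
  G w u ⊎ G v w

FullySuffixConnected : ∀ {n} → Digraph n → (Fin n → Fin n) → Fin n → Set
FullySuffixConnected G γ u = ∀ v → γ u < γ v → G v u

LeastFSC : ∀ {n} → Digraph n → (Fin n → Fin n) → Fin n → Set
LeastFSC G γ u = FullySuffixConnected G γ u ×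
  (∀ w → FullySuffixConnected G γ w → γ u ≤ γ w)

NoOutgoing : ∀ {n} → Digraph n → Fin n → Set
NoOutgoing G u = ∀ x → ¬ G u x

-- Permutation DAGs are transitive. If the γ-least fully suffix connected vertex u had an
-- out-neighbour, take one, y, with γ(y) as large as possible. Every v above y is then an
-- in-neighbour of y: above u by transitivity through u, and strictly between y and u by
-- the umbrella (u, y), since an arc (u, v) would contradict the choice of y. So y is fully
-- suffix connected and lies below u, contradicting the minimality of u.
module Submission where

open import Defs
open import Data.Nat using (ℕ)
import Data.Nat.Properties as ℕ
open import Data.Fin using (Fin; _<_; _>_; _≤_)
open import Data.Fin.Induction using (>-wellFounded)
open import Data.Fin.Properties using (<-cmp; <-trans)
open import Data.Product using (_,_; proj₁; proj₂)
open import Data.Sum using (inj₁; inj₂)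
open import Data.Empty using (⊥; ⊥-elim)
open import Function.Base using (_on_)
open import Function.Definitions using (Injective)
open import Induction.WellFounded using (Acc; acc)
open import Relation.Binary.Definitions using (Transitive; tri<; tri≈; tri>)
open import Relation.Binary.PropositionalEquality using (_≡_; subst; sym)
import Relation.Binary.Construct.On as On

permDAG-transitive : ∀ {n} (τ : Fin n → ℕ) → Transitive (PermDAG τ)
permDAG-transitive τ (j<i , τj≤τi) (k<j , τk≤τj) = <-trans k<j j<i , ℕ.≤-trans τk≤τj τj≤τi

isPermutationDAG⇒transitive : ∀ {n} {G : Digraph n} → IsPermutationDAG G → Transitive G
isPermutationDAG⇒transitive (τ , _ , _ , iso) {a} {b} {c} ab bc =
  proj₂ (iso a c) (permDAG-transitive τ (proj₁ (iso a b) ab) (proj₁ (iso b c) bc))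

module _ {n} {G : Digraph n} {γ : Fin n → Fin n}
         (transitive : Transitive G) (γ-injective : Injective _≡_ _≡_ γ)
         (descending : ∀ v u → G v u → γ u < γ v) (umbrellaFree : UmbrellaFree G γ)
         {u : Fin n} (fsc-u : FullySuffixConnected G γ u) where

  fsc-if-no-higher-outNeighbour : ∀ {y} → G u y →
    (∀ v → G u v → γ y < γ v → ⊥) → FullySuffixConnected G γ y
  fsc-if-no-higher-outNeighbour {y} uy noHigher v yv with <-cmp (γ v) (γ u)
  ... | tri< vu _ _ with umbrellaFree u y uy v yv vu
  ...   | inj₁ vy = vy
  ...   | inj₂ uv = ⊥-elim (noHigher v uv yv)
  fsc-if-no-higher-outNeighbour {y} uy noHigher v yv | tri≈ _ γv≡γu _ =
    subst (λ w → G w y) (sym (γ-injective γv≡γu)) uy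
  fsc-if-no-higher-outNeighbour {y} uy noHigher v yv | tri> _ _ uv =
    transitive (fsc-u v uv) uy

  least-fsc⇒noOutgoing : (∀ w → FullySuffixConnected G γ w → γ u ≤ γ w) →
    NoOutgoing G u
  least-fsc⇒noOutgoing least y = go y (On.wellFounded γ >-wellFounded y)
    where
    go : ∀ y → Acc (_>_ on γ) y → G u y → ⊥
    go y (acc higher) uy =
      ℕ.<⇒≱ (descending u y uy)
        (least y (fsc-if-no-higher-outNeighbour uy (λ v uv yv → go v (higher yv) uv)))

lemma3 : (n : ℕ) (G : Digraph n) (γ : Fin n → Fin n) →
    IsPermutationDAG G → IsTopOrdering G γ → UmbrellaFree G γ →
    (u : Fin n) → LeastFSC G γ u → NoOutgoing G u
lemma3 n G γ permDAG (γ-bijective , descending) umbrellaFree u (fsc-u , least) =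
  least-fsc⇒noOutgoing (isPermutationDAG⇒transitive permDAG) (proj₁ γ-bijective)
    descending umbrellaFree fsc-u least
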